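{- Let $k$ be a field or $\mathbb{Z}$, and let $G$ be a finite simple graph whose independence complex $I(G)$ is sequentially Cohen-Macaulay over $k$. Then $\tilde H_j(I(G);k)=0$ for all $j<i(G)-1$.
   Context: $I(G)$ is the simplicial complex on $V(G)$ whose faces are the independent sets of $G$. $i(G)$, the independent domination number, is the minimum cardinality of a maximal independent set of $G$. A complex is sequentially Cohen-Macaulay over $k$ if for every $i$ the subcomplex generated by its $i$-dimensional faces is Cohen-Macaulay over $k$ (i.e., for every face $F$ of it, $\tilde H_m(\operatorname{link} F;k)=0$ for $m<\dim\operatorname{link}F$). -}

module Defs where

open import Level using (0ℓ)
open import Data.Nat using (ℕ; zero; suc; _<_; _≤_)
open import Data.Bool using (Bool; true; false; if_then_else_)
open import Data.Fin using (Fin; zero; suc; _<?_)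
open import Data.Fin.Subset using (Subset; _∈_; _∉_; _⊆_; _∪_; _∩_; ⁅_⁆; ∣_∣; Empty)
open import Data.Vec using (lookup)
open import Data.Product using (Σ; ∃; _×_; _,_)
open import Data.Sum using (_⊎_)
open import Relation.Nullary using (¬_; yes; no)
open import Relation.Binary.PropositionalEquality using (_≡_)
open import Algebra.Bundles using (CommutativeRing)
import Data.Integer.Properties as ℤP

IsField : CommutativeRing 0ℓ 0ℓ → Set
IsField R = (¬ (1# ≈ 0#)) × (∀ x → ¬ (x ≈ 0#) → ∃ λ y → (x * y) ≈ 1#)
  where open CommutativeRing R

data Coefficients : Set₁ where
  field′   : (F : CommutativeRing 0ℓ 0ℓ) → IsField F → Coefficients
  integers : Coefficients

ringOf : Coefficients → CommutativeRing 0ℓ 0ℓ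
ringOf (field′ F _) = F
ringOf integers     = ℤP.+-*-commutativeRing

record Graph (n : ℕ) : Set₁ where
  field
    Adj       : Fin n → Fin n → Set
    Adj-sym   : ∀ {u v} → Adj u v → Adj v u
    Adj-irrefl : ∀ {u} → ¬ Adj u u

module _ {n : ℕ} (G : Graph n) where
  open Graph G

  Independent : Subset n → Set
  Independent S = ∀ u v → u ∈ S → v ∈ S → ¬ Adj u v

  MaximalIndependent : Subset n → Set
  MaximalIndependent S =
    Independent S × (∀ v → v ∉ S → ¬ Independent (S ∪ ⁅ v ⁆))

  IsIndepDomNumber : ℕ → Set
  IsIndepDomNumber m =
    (∃ λ S → MaximalIndependent S × ∣ S ∣ ≡ m) ×
    (∀ S → MaximalIndependent S → m ≤ ∣ S ∣)

Complex : ℕ → Set₁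
Complex n = Subset n → Set

Ind : ∀ {n} → Graph n → Complex n
Ind G = Independent G

link : ∀ {n} → Complex n → Subset n → Complex n
link Δ F S = Empty (S ∩ F) × Δ (S ∪ F)

-- subcomplex generated by the faces of size t (i.e. of dimension t - 1)
pureSkel : ∀ {n} → Complex n → ℕ → Complex n
pureSkel Δ t S = ∃ λ T → Δ T × ∣ T ∣ ≡ t × S ⊆ T

module Homology (R : CommutativeRing 0ℓ 0ℓ) where
  open CommutativeRing R hiding (zero)

  sumFin : ∀ {n} → (Fin n → Carrier) → Carrier
  sumFin {zero}  f = 0#
  sumFin {suc n} f = f zero + sumFin (λ i → f (suc i))

  countBelow : ∀ {n} → Subset n → Fin n → ℕ
  countBelow {n} T v = go n (λ u → u)
    where
    go : (m : ℕ) → (Fin m → Fin n) → ℕ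
    go zero    ι = 0
    go (suc m) ι with ι zero <? v
    ... | yes _ = (if lookup T (ι zero) then suc else (λ x → x)) (go m (λ i → ι (suc i)))
    ... | no  _ = go m (λ i → ι (suc i))

  signPow : ℕ → Carrier
  signPow zero    = 1#
  signPow (suc k) = - signPow k

  -- chains are functions on subsets; an s-chain of Δ (s = dimension + 1,
  -- so s = 0 is the augmentation degree -1) vanishes off faces of size s
  Chain : ∀ {n} → Set
  Chain {n} = Subset n → Carrier

  IsChain : ∀ {n} → Complex n → ℕ → Chain {n} → Set
  IsChain Δ s c = ∀ S → ¬ (Δ S × ∣ S ∣ ≡ s) → c S ≈ 0#

  -- simplicial boundary, vertices ordered by Fin order:
  -- (∂c)(T) = Σ_{v ∉ T} (-1)^{#{u ∈ T | u < v}} c(T ∪ {v})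
  ∂ : ∀ {n} → Chain {n} → Chain {n}
  ∂ c T = sumFin (λ v → if lookup T v then 0#
                        else signPow (countBelow T v) * c (T ∪ ⁅ v ⁆))

  -- H̃_{s-1}(Δ; R) = 0
  HVanishes : ∀ {n} → Complex n → ℕ → Set
  HVanishes Δ s = ∀ c → IsChain Δ s c → (∀ T → ∂ c T ≈ 0#) →
                  ∃ λ b → IsChain Δ (suc s) b × (∀ S → ∂ b S ≈ c S)

  -- Cohen–Macaulay: for every face F, H̃_m(lk F) = 0 for m < dim lk F,
  -- i.e. (with s = m + 1) for all s smaller than the size of some face of lk F
  CohenMacaulay : ∀ {n} → Complex n → Set
  CohenMacaulay Δ = ∀ F → Δ F → ∀ s →
                    (∃ λ S → link Δ F S × s < ∣ S ∣) → HVanishes (link Δ F) s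

  SequentiallyCM : ∀ {n} → Complex n → Set
  SequentiallyCM Δ = ∀ t → CohenMacaulay (pureSkel Δ t)

module Submission where

open import Defs
open import Data.Nat using (ℕ; _<_)
open import Algebra.Bundles using (CommutativeRing)

open import Level using (0ℓ)
open import Data.Nat using (zero; suc; _≤_; z≤n; s≤s)
open import Data.Nat.Properties using (≤-refl; <⇒≱)
open import Data.Vec using ([]; _∷_; here; there)
open import Data.Fin using (Fin; zero; suc)
open import Data.Fin.Subset using (Subset; _∈_; _∉_; _⊆_; _∪_; _∩_; ⁅_⁆; Empty; ∣_∣; ⊥; inside; outside)
open import Data.Fin.Subset.Properties
  using (∉⊥; ⊥⊆; ⊆-refl; ∪-identityʳ; ∩-zeroʳ; p⊆p∪q)
open import Data.Product using (∃; _×_; _,_)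
open import Relation.Nullary using (¬_; ¬¬-map)
open import Data.Empty using () renaming (⊥-elim to absurd)
open import Relation.Binary.PropositionalEquality using (_≡_; refl; sym; subst; cong)

-- Let s < i(G) and put Δ = I(G).  Reduced homology in degree
-- s - 1 only sees the faces of size s and s + 1 (chains live on the former,
-- fillings on the latter).  These faces are the same in Δ and in its pure
-- skeleton Δ⁽ˢ⁺¹⁾ generated by the faces of size s + 1: an independent set
-- of size s < i(G) is not maximal, so (up to double negation, which suffices
-- because being a chain is a negative condition) it lies in a face of size
-- s + 1.  Since i(G) > s, Δ⁽ˢ⁺¹⁾ is nonempty and of dimension s, and sequential
-- Cohen–Macaulayness says it is Cohen–Macaulay; applied at the empty face,
-- whose link is the complex itself, this gives H̃_{s-1}(Δ⁽ˢ⁺¹⁾) = 0, hence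
-- H̃_{s-1}(Δ) = 0.

subsetOfSize : ∀ {n} (M : Subset n) k → k ≤ ∣ M ∣ → ∃ λ T → T ⊆ M × ∣ T ∣ ≡ k
subsetOfSize []            zero    _       = [] , (λ ()) , refl
subsetOfSize (outside ∷ M) k       k≤M     with subsetOfSize M k k≤M
... | T , T⊆M , |T| = outside ∷ T , (λ { (there x∈) → there (T⊆M x∈) }) , |T|
subsetOfSize (inside ∷ M)  zero    _       with subsetOfSize M zero z≤n
... | T , T⊆M , |T| = outside ∷ T , (λ { (there x∈) → there (T⊆M x∈) }) , |T|
subsetOfSize (inside ∷ M)  (suc k) (s≤s k≤M) with subsetOfSize M k k≤M
... | T , T⊆M , |T| = inside ∷ T , (λ { here → here ; (there x∈) → there (T⊆M x∈) }) ,
                      cong suc |T|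

∣p∪⁅x⁆∣ : ∀ {n} (p : Subset n) (x : Fin n) → x ∉ p → ∣ p ∪ ⁅ x ⁆ ∣ ≡ suc ∣ p ∣
∣p∪⁅x⁆∣ (outside ∷ p) zero    _   = cong (λ q → suc ∣ q ∣) (∪-identityʳ p)
∣p∪⁅x⁆∣ (inside ∷ p)  zero    x∉p = absurd (x∉p here)
∣p∪⁅x⁆∣ (outside ∷ p) (suc x) x∉p = ∣p∪⁅x⁆∣ p x (λ x∈ → x∉p (there x∈))
∣p∪⁅x⁆∣ (inside ∷ p)  (suc x) x∉p = cong suc (∣p∪⁅x⁆∣ p x (λ x∈ → x∉p (there x∈)))

DownClosed : ∀ {n} → Complex n → Set
DownClosed Δ = ∀ {S T} → S ⊆ T → Δ T → Δ S

pureSkel⊆ : ∀ {n} {Δ : Complex n} {t S} → DownClosed Δ → pureSkel Δ t S → Δ S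
pureSkel⊆ down (T , ΔT , _ , S⊆T) = down S⊆T ΔT

link∅⁺ : ∀ {n} {Δ : Complex n} {S} → Δ S → link Δ ⊥ S
link∅⁺ {Δ = Δ} {S} ΔS = disjoint , subst Δ (sym (∪-identityʳ S)) ΔS
  where
  disjoint : Empty (S ∩ ⊥)
  disjoint (x , x∈S∩⊥) = ∉⊥ (subst (x ∈_) (∩-zeroʳ S) x∈S∩⊥)

link∅⁻ : ∀ {n} {Δ : Complex n} {S} → link Δ ⊥ S → Δ S
link∅⁻ {Δ = Δ} {S} (_ , ΔS∪⊥) = subst Δ (∪-identityʳ S) ΔS∪⊥

-- Reduced homology in degree s - 1 depends only on the faces of sizes s and
-- s + 1.  Face membership only needs to be known up to double negation,
-- because being a chain of Δ is a negative condition on Δ.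
module _ (R : CommutativeRing 0ℓ 0ℓ) where
  open Homology R

  IsChain-transfer : ∀ {n} {Δ Δ′ : Complex n} {s} {c : Chain} →
    (∀ S → ∣ S ∣ ≡ s → Δ′ S → ¬ ¬ Δ S) →
    IsChain Δ′ s c → IsChain Δ s c
  IsChain-transfer Δ′⊆Δ chain S notFace =
    chain S λ { (Δ′S , |S|) → Δ′⊆Δ S |S| Δ′S (λ ΔS → notFace (ΔS , |S|)) }

  HVanishes-transfer : ∀ {n} {Δ Δ′ : Complex n} {s} →
    (∀ S → ∣ S ∣ ≡ s → Δ S → ¬ ¬ Δ′ S) →
    (∀ S → ∣ S ∣ ≡ suc s → Δ′ S → ¬ ¬ Δ S) →
    HVanishes Δ′ s → HVanishes Δ s
  HVanishes-transfer sizeS sizeSuc vanishes c chain cycle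
    with vanishes c (IsChain-transfer sizeS chain) cycle
  ... | b , bChain , ∂b≈c = b , IsChain-transfer sizeSuc bChain , ∂b≈c

module _ {n : ℕ} (G : Graph n) where

  Ind-downClosed : DownClosed (Ind G)
  Ind-downClosed S⊆T indT u v u∈S v∈S = indT u v (S⊆T u∈S) (S⊆T v∈S)

  independentOfSize : ∀ {M} k → Independent G M → k ≤ ∣ M ∣ →
                      ∃ λ T → Independent G T × ∣ T ∣ ≡ k
  independentOfSize {M} k indM k≤M with subsetOfSize M k k≤M
  ... | T , T⊆M , |T| = T , Ind-downClosed T⊆M indM , |T|

  -- If every maximal independent set has at least i elements, then an
  -- independent set S with fewer elements is not maximal, so (up to double
  -- negation) it lies in an independent set of size ∣S∣ + 1.
  smallIndependent-inSkeleton : ∀ {i S} →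
    (∀ T → MaximalIndependent G T → i ≤ ∣ T ∣) →
    Independent G S → ∣ S ∣ < i → ¬ ¬ pureSkel (Ind G) (suc ∣ S ∣) S
  smallIndependent-inSkeleton {S = S} minimal indS small notInSkeleton =
    <⇒≱ small (minimal S (indS , maximal))
    where
    maximal : ∀ v → v ∉ S → ¬ Independent G (S ∪ ⁅ v ⁆)
    maximal v v∉S indS∪v =
      notInSkeleton (S ∪ ⁅ v ⁆ , indS∪v , ∣p∪⁅x⁆∣ S v v∉S , p⊆p∪q ⁅ v ⁆)

corollary5p3 : (k : Coefficients) → (n : ℕ) → (G : Graph n) →
    Homology.SequentiallyCM (ringOf k) (Ind G) →
    (i : ℕ) → IsIndepDomNumber G i →
    ∀ s → s < i → Homology.HVanishes (ringOf k) (Ind G) s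
corollary5p3 k n G seqCM i ((M , (indM , _) , |M|≡i) , minimal) s s<i =
  HVanishes-transfer (ringOf k) sizeS sizeSuc skeletonVanishes
  where
  Skel : Complex n
  Skel = pureSkel (Ind G) (suc s)

  top : ∃ λ T → Independent G T × ∣ T ∣ ≡ suc s
  top = independentOfSize G (suc s) indM (subst (suc s ≤_) (sym |M|≡i) s<i)

  -- Cohen–Macaulayness of Skel at the empty face, below the dimension of T
  skeletonVanishes : Homology.HVanishes (ringOf k) (link Skel ⊥) s
  skeletonVanishes with top
  ... | T , indT , |T| =
    seqCM (suc s) ⊥ (T , indT , |T| , ⊥⊆) s
      (T , link∅⁺ {Δ = Skel} (T , indT , |T| , ⊆-refl) , subst (s <_) (sym |T|) ≤-refl)

  -- size-s faces of I(G) lie in Skel, as they are not maximal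
  sizeS : ∀ S → ∣ S ∣ ≡ s → Ind G S → ¬ ¬ link Skel ⊥ S
  sizeS S |S| indS = ¬¬-map (link∅⁺ {Δ = Skel})
    (subst (λ t → ¬ ¬ pureSkel (Ind G) (suc t) S) |S|
      (smallIndependent-inSkeleton G minimal indS (subst (_< i) (sym |S|) s<i)))

  sizeSuc : ∀ S → ∣ S ∣ ≡ suc s → link Skel ⊥ S → ¬ ¬ Ind G S
  sizeSuc S _ inSkel notInd = notInd (pureSkel⊆ (Ind-downClosed G) (link∅⁻ {Δ = Skel} inSkel))
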